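{- For every connected graph $G$ of order at least $2$, $\mathrm{msd}_{\gamma_t}(G)\leq 3$.
   Context: A set $S\subseteq V(G)$ is a total dominating set of $G$ if every vertex of $G$ is adjacent to a vertex of $S$; $\gamma_t(G)$ is the minimum size of such a set. For an edge $e=uv$ and integer $t\ge1$, $G_{e,t}$ denotes the graph obtained from $G$ by replacing the edge $uv$ by a path $(u,x_1,\dots,x_t,v)$ with $t$ new vertices. $\mathrm{msd}_{\gamma_t}(uv)$ is the minimum positive integer $t$ such that $\gamma_t(G_{uv,t})>\gamma_t(G)$, and $\mathrm{msd}_{\gamma_t}(G)=\min\{\mathrm{msd}_{\gamma_t}(uv): uv\in E(G)\}$. -}

module Defs where

open import Data.Nat using (ℕ; zero; suc; _+_; _≡ᵇ_; _<_; _≤_; _∸_)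
open import Data.Bool using (Bool; true; false; _∧_; _∨_; not)
open import Data.Fin using (Fin; toℕ; splitAt)
open import Data.Fin.Subset using (Subset; _∈_; ∣_∣)
open import Data.Sum using (_⊎_; inj₁; inj₂)
open import Data.Product using (Σ; ∃; _×_; _,_)
open import Relation.Binary.PropositionalEquality using (_≡_)

Adj : ℕ → Set
Adj n = Fin n → Fin n → Bool

record Graph (n : ℕ) : Set where
  field
    adj    : Adj n
    sym    : ∀ a b → adj a b ≡ adj b a
    irrefl : ∀ a → adj a a ≡ false
open Graph public

data Reachable {n : ℕ} (A : Adj n) : Fin n → Fin n → Set where
  here : ∀ {a} → Reachable A a a
  step : ∀ {a b c} → A a b ≡ true → Reachable A b c → Reachable A a c

Connected : ∀ {n} → Graph n → Set
Connected G = ∀ a b → Reachable (adj G) a b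

IsTotalDominating : ∀ {n} → Adj n → Subset n → Set
IsTotalDominating A S = ∀ v → ∃ λ w → (w ∈ S) × (A v w ≡ true)

IsTotalDomNumber : ∀ {n} → Adj n → ℕ → Set
IsTotalDomNumber {n} A k =
  (Σ (Subset n) λ S → IsTotalDominating A S × ∣ S ∣ ≡ k) ×
  (∀ (S : Subset n) → IsTotalDominating A S → k ≤ ∣ S ∣)

_=ꟳ_ : ∀ {n} → Fin n → Fin n → Bool
a =ꟳ b = toℕ a ≡ᵇ toℕ b

-- Adjacency of G_{uv,t}: vertices Fin (n + t); the old vertices are the first n
-- (Fin n embedded via splitAt), the new vertex with index i : Fin t is x_{i+1}.
-- The edge uv is removed and replaced by the path u, x_1, …, x_t, v.
subdivide : ∀ {n} → Graph n → Fin n → Fin n → (t : ℕ) → Adj (n + t)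
subdivide {n} G u v t p q with splitAt n p | splitAt n q
... | inj₁ a | inj₁ b = adj G a b ∧ not ((a =ꟳ u ∧ b =ꟳ v) ∨ (a =ꟳ v ∧ b =ꟳ u))
... | inj₁ a | inj₂ j = (a =ꟳ u ∧ (toℕ j ≡ᵇ 0)) ∨ (a =ꟳ v ∧ (toℕ j ≡ᵇ (t ∸ 1)))
... | inj₂ i | inj₁ b = (b =ꟳ u ∧ (toℕ i ≡ᵇ 0)) ∨ (b =ꟳ v ∧ (toℕ i ≡ᵇ (t ∸ 1)))
... | inj₂ i | inj₂ j = (suc (toℕ i) ≡ᵇ toℕ j) ∨ (suc (toℕ j) ≡ᵇ toℕ i)

SubdivisionIncreases : ∀ {n} → Graph n → Fin n → Fin n → ℕ → Set
SubdivisionIncreases {n} G u v t =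
  ∃ λ k → ∃ λ k' → IsTotalDomNumber (adj G) k ×
    IsTotalDomNumber (subdivide G u v t) k' × k < k'

-- msd_{γ_t}(G) ≤ m : for some edge uv, msd_{γ_t}(uv) ≤ m, i.e. some positive
-- t ≤ m has γ_t(G_{uv,t}) > γ_t(G) (msd_{γ_t}(uv) being the least such t).
MsdAtMost : ∀ {n} → Graph n → ℕ → Set
MsdAtMost {n} G m =
  ∃ λ (u : Fin n) → ∃ λ (v : Fin n) → (adj G u v ≡ true) ×
    (∃ λ t → 1 ≤ t × t ≤ m × SubdivisionIncreases G u v t)

-- Subdivide any edge uv of G three times, obtaining u, x₁, x₂, x₃, v. A total
-- dominating set S' of the subdivided graph has to dominate x₂, so it contains
-- x₁ or x₃. Its old part, enlarged by v if x₁ ∈ S' and by u if x₃ ∈ S', totally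
-- dominates G. If x₂ ∈ S' this set is smaller than S', as x₂ is dropped; if
-- x₂ ∉ S' then u, v ∈ S' are needed for x₁ and x₃, so nothing is added while
-- x₁ or x₃ is dropped. Hence γ_t strictly increases. Connectivity with at least
-- two vertices only serves to provide an edge and to rule out isolated
-- vertices, without which γ_t would not exist.
module Submission where

open import Defs hiding (sym)
open import Data.Bool using (true; false; _∧_; _∨_; not)
import Data.Bool as Bool
open import Data.Bool.Properties using (T-≡; ∧-conicalˡ; ∧-identityʳ; ∧-zeroʳ; ∨-identityʳ)
open import Data.Fin using (Fin; zero; suc; toℕ; splitAt; _↑ˡ_; _↑ʳ_)
open import Data.Fin.Patterns using (0F; 1F; 2F)
open import Data.Fin.Properties using (toℕ-injective; splitAt-↑ˡ; splitAt-↑ʳ; splitAt⁻¹-↑ˡ; splitAt⁻¹-↑ʳ; all?; any?)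
open import Data.Fin.Subset using (Subset; _∈_; _⊆_; ∣_∣; _∪_; ⁅_⁆; ⊤; inside; outside)
open import Data.Fin.Subset.Properties
  using (_∈?_; anySubset?; ∈⊤; x∈⁅x⁆; ∣⁅x⁆∣≡1; p⊆p∪q; q⊆p∪q; x∈p⇒∣p-x∣<∣p∣)
open import Data.Nat using (ℕ; zero; suc; _+_; _≤_; _<_; _≡ᵇ_; z≤n; s≤s; _<?_)
open import Data.Nat.Induction using (<-wellFounded)
open import Data.Nat.Properties
  using (≡ᵇ⇒≡; ≤-refl; ≤-reflexive; ≤-trans; ≤-<-trans; ≮⇒≥; <-≤-trans; +-comm; +-suc; m≤n⇒m≤1+n; m<m+n; module ≤-Reasoning)
open import Data.Product using (∃; _×_; _,_)
open import Data.Sum using (_⊎_; inj₁; inj₂; [_,_]′)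
open import Data.Vec using ([]; _∷_; _++_; here; there)
import Data.Vec as Vec
open import Data.Vec.Properties using ([]=⇒lookup; lookup⇒[]=; lookup-++ˡ; lookup-++ʳ)
open import Function using (_∘_; const)
open import Function.Bundles using (Equivalence)
open import Induction.WellFounded using (Acc; acc)
open import Relation.Binary.PropositionalEquality using (_≡_; refl; sym; trans; cong; subst)
open import Relation.Nullary using (yes; no)
open import Relation.Nullary.Decidable using (_×-dec_)
open import Relation.Unary using (Pred; Decidable)

=ꟳ⇒≡ : ∀ {n} {a b : Fin n} → a =ꟳ b ≡ true → a ≡ b
=ꟳ⇒≡ {a = a} {b} eq = toℕ-injective (≡ᵇ⇒≡ (toℕ a) (toℕ b) (Equivalence.from T-≡ eq))

∣p++q∣≡∣p∣+∣q∣ : ∀ {m k} (p : Subset m) (q : Subset k) → ∣ p ++ q ∣ ≡ ∣ p ∣ + ∣ q ∣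
∣p++q∣≡∣p∣+∣q∣ []            q = refl
∣p++q∣≡∣p∣+∣q∣ (inside ∷ p)  q = cong suc (∣p++q∣≡∣p∣+∣q∣ p q)
∣p++q∣≡∣p∣+∣q∣ (outside ∷ p) q = ∣p++q∣≡∣p∣+∣q∣ p q

∣p∪q∣≤∣p∣+∣q∣ : ∀ {m} (p q : Subset m) → ∣ p ∪ q ∣ ≤ ∣ p ∣ + ∣ q ∣
∣p∪q∣≤∣p∣+∣q∣ []            []            = z≤n
∣p∪q∣≤∣p∣+∣q∣ (inside ∷ p)  (inside ∷ q)  =
  s≤s (≤-trans (m≤n⇒m≤1+n (∣p∪q∣≤∣p∣+∣q∣ p q)) (≤-reflexive (sym (+-suc ∣ p ∣ ∣ q ∣))))
∣p∪q∣≤∣p∣+∣q∣ (inside ∷ p)  (outside ∷ q) = s≤s (∣p∪q∣≤∣p∣+∣q∣ p q)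
∣p∪q∣≤∣p∣+∣q∣ (outside ∷ p) (inside ∷ q)  =
  ≤-trans (s≤s (∣p∪q∣≤∣p∣+∣q∣ p q)) (≤-reflexive (sym (+-suc ∣ p ∣ ∣ q ∣)))
∣p∪q∣≤∣p∣+∣q∣ (outside ∷ p) (outside ∷ q) = ∣p∪q∣≤∣p∣+∣q∣ p q

∣p∪⁅x⁆∣≤1+∣p∣ : ∀ {m} (p : Subset m) x → ∣ p ∪ ⁅ x ⁆ ∣ ≤ suc ∣ p ∣
∣p∪⁅x⁆∣≤1+∣p∣ p x = ≤-trans (∣p∪q∣≤∣p∣+∣q∣ p ⁅ x ⁆)
  (≤-reflexive (trans (cong (∣ p ∣ +_) (∣⁅x⁆∣≡1 x)) (+-comm ∣ p ∣ 1)))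

x∈p⇒0<∣p∣ : ∀ {m} {p : Subset m} {x} → x ∈ p → 0 < ∣ p ∣
x∈p⇒0<∣p∣ x∈p = ≤-<-trans z≤n (x∈p⇒∣p-x∣<∣p∣ x∈p)

x↑ˡ∈p++q⇒x∈p : ∀ {m k} (p : Subset m) (q : Subset k) x → x ↑ˡ k ∈ p ++ q → x ∈ p
x↑ˡ∈p++q⇒x∈p p q x x∈ = lookup⇒[]= x p (trans (sym (lookup-++ˡ p q x)) ([]=⇒lookup x∈))

m↑ʳx∈p++q⇒x∈q : ∀ {m k} (p : Subset m) (q : Subset k) x → m ↑ʳ x ∈ p ++ q → x ∈ q
m↑ʳx∈p++q⇒x∈q p q x x∈ = lookup⇒[]= x q (trans (sym (lookup-++ʳ p q x)) ([]=⇒lookup x∈))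

minimal-cardinality : ∀ {m ℓ} {P : Pred (Subset m) ℓ} → Decidable P → ∀ {S} → P S →
                      ∃ λ T → P T × (∀ R → P R → ∣ T ∣ ≤ ∣ R ∣)
minimal-cardinality {P = P} P? {S} pS = descend S pS (<-wellFounded ∣ S ∣)
  where
  descend : ∀ S → P S → Acc _<_ ∣ S ∣ → ∃ λ T → P T × (∀ R → P R → ∣ T ∣ ≤ ∣ R ∣)
  descend S pS (acc smaller) with anySubset? (λ R → P? R ×-dec (∣ R ∣ <? ∣ S ∣))
  ... | yes (R , pR , R<S) = descend R pR (smaller R<S)
  ... | no ∄R = S , pS , λ R pR → ≮⇒≥ (λ R<S → ∄R (R , pR , R<S))

NoIsolatedVertex : ∀ {n} → Adj n → Set
NoIsolatedVertex {n} A = ∀ a → ∃ λ (b : Fin n) → A a b ≡ true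

⊤-isTotalDominating : ∀ {n} {A : Adj n} → NoIsolatedVertex A → IsTotalDominating A ⊤
⊤-isTotalDominating noIso a with noIso a
... | b , ab = b , ∈⊤ , ab

isTotalDominating? : ∀ {n} (A : Adj n) → Decidable (IsTotalDominating A)
isTotalDominating? A S = all? λ a → any? λ b → (b ∈? S) ×-dec (A a b Bool.≟ true)

totalDomNumber-exists : ∀ {n} {A : Adj n} {S} → IsTotalDominating A S → ∃ (IsTotalDomNumber A)
totalDomNumber-exists {A = A} dom with minimal-cardinality (isTotalDominating? A) dom
... | T , domT , minimal = ∣ T ∣ , (T , domT , refl) , minimal

totalDomNumber-< : ∀ {n n′} {A : Adj n} {B : Adj n′} {k k′} →
                   IsTotalDomNumber A k → IsTotalDomNumber B k′ →
                   (∀ S′ → IsTotalDominating B S′ → ∃ λ S → IsTotalDominating A S × ∣ S ∣ < ∣ S′ ∣) →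
                   k < k′
totalDomNumber-< (_ , minimalA) ((S′ , domS′ , refl) , _) shrinks with shrinks S′ domS′
... | S , domS , S<S′ = ≤-<-trans (minimalA S domS) S<S′

module ThreefoldSubdivision {n} (G : Graph n) (u v : Fin n) where

  G₃ : Adj (n + 3)
  G₃ = subdivide G u v 3

  old : Fin n → Fin (n + 3)
  old a = a ↑ˡ 3

  x₁ x₂ x₃ : Fin (n + 3)
  x₁ = n ↑ʳ 0F
  x₂ = n ↑ʳ 1F
  x₃ = n ↑ʳ 2F

  data Vertex : Fin (n + 3) → Set where
    oldᵛ : ∀ a → Vertex (old a)
    newᵛ : ∀ j → Vertex (n ↑ʳ j)

  vertex : ∀ w → Vertex w
  vertex w with splitAt n w in eq
  ... | inj₁ a = subst Vertex (splitAt⁻¹-↑ˡ eq) (oldᵛ a)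
  ... | inj₂ j = subst Vertex (splitAt⁻¹-↑ʳ eq) (newᵛ j)

  adj-old-old : ∀ a b → G₃ (old a) (old b) ≡ adj G a b ∧ not ((a =ꟳ u ∧ b =ꟳ v) ∨ (a =ꟳ v ∧ b =ꟳ u))
  adj-old-old a b rewrite splitAt-↑ˡ n a 3 | splitAt-↑ˡ n b 3 = refl

  adj-old-old⁺ : ∀ {a b} → a =ꟳ u ≡ false → a =ꟳ v ≡ false → adj G a b ≡ true → G₃ (old a) (old b) ≡ true
  adj-old-old⁺ {a} {b} a≠u a≠v a~b rewrite adj-old-old a b | a≠u | a≠v | ∧-identityʳ (adj G a b) = a~b

  adj-old-x₁ : ∀ a → G₃ (old a) x₁ ≡ a =ꟳ u
  adj-old-x₁ a rewrite splitAt-↑ˡ n a 3 | splitAt-↑ʳ n 3 0F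
                     | ∧-identityʳ (a =ꟳ u) | ∧-zeroʳ (a =ꟳ v) = ∨-identityʳ _

  adj-old-x₂ : ∀ a → G₃ (old a) x₂ ≡ false
  adj-old-x₂ a rewrite splitAt-↑ˡ n a 3 | splitAt-↑ʳ n 3 1F
                     | ∧-zeroʳ (a =ꟳ u) | ∧-zeroʳ (a =ꟳ v) = refl

  adj-old-x₃ : ∀ a → G₃ (old a) x₃ ≡ a =ꟳ v
  adj-old-x₃ a rewrite splitAt-↑ˡ n a 3 | splitAt-↑ʳ n 3 2F
                     | ∧-zeroʳ (a =ꟳ u) | ∧-identityʳ (a =ꟳ v) = refl

  adj-x₁-old : ∀ b → G₃ x₁ (old b) ≡ b =ꟳ u
  adj-x₁-old b rewrite splitAt-↑ʳ n 3 0F | splitAt-↑ˡ n b 3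
                     | ∧-identityʳ (b =ꟳ u) | ∧-zeroʳ (b =ꟳ v) = ∨-identityʳ _

  adj-x₂-old : ∀ b → G₃ x₂ (old b) ≡ false
  adj-x₂-old b rewrite splitAt-↑ʳ n 3 1F | splitAt-↑ˡ n b 3
                     | ∧-zeroʳ (b =ꟳ u) | ∧-zeroʳ (b =ꟳ v) = refl

  adj-x₃-old : ∀ b → G₃ x₃ (old b) ≡ b =ꟳ v
  adj-x₃-old b rewrite splitAt-↑ʳ n 3 2F | splitAt-↑ˡ n b 3
                     | ∧-zeroʳ (b =ꟳ u) | ∧-identityʳ (b =ꟳ v) = refl

  adj-new-new : ∀ i j → G₃ (n ↑ʳ i) (n ↑ʳ j) ≡ (suc (toℕ i) ≡ᵇ toℕ j) ∨ (suc (toℕ j) ≡ᵇ toℕ i)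
  adj-new-new i j rewrite splitAt-↑ʳ n 3 i | splitAt-↑ʳ n 3 j = refl

  nonadjacent : ∀ {p q} {A : Set} → G₃ p q ≡ false → G₃ p q ≡ true → A
  nonadjacent p≁q p~q with () ← trans (sym p≁q) p~q

  neighbours-old : ∀ a w → G₃ (old a) w ≡ true →
                   (∃ λ b → w ≡ old b × adj G a b ≡ true) ⊎ (a ≡ u × w ≡ x₁) ⊎ (a ≡ v × w ≡ x₃)
  neighbours-old a w a~w with vertex w
  ... | oldᵛ b = inj₁ (b , refl , ∧-conicalˡ _ _ (trans (sym (adj-old-old a b)) a~w))
  ... | newᵛ 0F = inj₂ (inj₁ (=ꟳ⇒≡ (trans (sym (adj-old-x₁ a)) a~w) , refl))
  ... | newᵛ 1F = nonadjacent (adj-old-x₂ a) a~w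
  ... | newᵛ 2F = inj₂ (inj₂ (=ꟳ⇒≡ (trans (sym (adj-old-x₃ a)) a~w) , refl))

  neighbours-x₁ : ∀ w → G₃ x₁ w ≡ true → w ≡ old u ⊎ w ≡ x₂
  neighbours-x₁ w x₁~w with vertex w
  ... | oldᵛ b = inj₁ (cong old (=ꟳ⇒≡ (trans (sym (adj-x₁-old b)) x₁~w)))
  ... | newᵛ 0F = nonadjacent (adj-new-new 0F 0F) x₁~w
  ... | newᵛ 1F = inj₂ refl
  ... | newᵛ 2F = nonadjacent (adj-new-new 0F 2F) x₁~w

  neighbours-x₂ : ∀ w → G₃ x₂ w ≡ true → w ≡ x₁ ⊎ w ≡ x₃
  neighbours-x₂ w x₂~w with vertex w
  ... | oldᵛ b = nonadjacent (adj-x₂-old b) x₂~w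
  ... | newᵛ 0F = inj₁ refl
  ... | newᵛ 1F = nonadjacent (adj-new-new 1F 1F) x₂~w
  ... | newᵛ 2F = inj₂ refl

  neighbours-x₃ : ∀ w → G₃ x₃ w ≡ true → w ≡ x₂ ⊎ w ≡ old v
  neighbours-x₃ w x₃~w with vertex w
  ... | oldᵛ b = inj₂ (cong old (=ꟳ⇒≡ (trans (sym (adj-x₃-old b)) x₃~w)))
  ... | newᵛ 0F = nonadjacent (adj-new-new 2F 0F) x₃~w
  ... | newᵛ 1F = inj₁ refl
  ... | newᵛ 2F = nonadjacent (adj-new-new 2F 2F) x₃~w

  noIsolatedVertex : NoIsolatedVertex (adj G) → NoIsolatedVertex G₃
  noIsolatedVertex noIso w with vertex w
  ... | newᵛ 0F = x₂ , adj-new-new 0F 1F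
  ... | newᵛ 1F = x₁ , adj-new-new 1F 0F
  ... | newᵛ 2F = x₂ , adj-new-new 2F 1F
  ... | oldᵛ a with a =ꟳ u in a=u | a =ꟳ v in a=v | noIso a
  ...   | true  | _     | _       = x₁ , trans (adj-old-x₁ a) a=u
  ...   | false | true  | _       = x₃ , trans (adj-old-x₃ a) a=v
  ...   | false | false | b , a~b = old b , adj-old-old⁺ a=u a=v a~b

  module Dominated (xs : Subset n) (ys : Subset 3) (dom : IsTotalDominating G₃ (xs ++ ys)) where

    old∈ : ∀ {b} → old b ∈ xs ++ ys → b ∈ xs
    old∈ = x↑ˡ∈p++q⇒x∈p xs ys _

    new∈ : ∀ {j} → n ↑ʳ j ∈ xs ++ ys → j ∈ ys
    new∈ = m↑ʳx∈p++q⇒x∈q xs ys _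

    x₁-dominated : u ∈ xs ⊎ 1F ∈ ys
    x₁-dominated with dom x₁
    ... | w , w∈ , x₁~w with neighbours-x₁ w x₁~w
    ...   | inj₁ refl = inj₁ (old∈ w∈)
    ...   | inj₂ refl = inj₂ (new∈ w∈)

    x₂-dominated : 0F ∈ ys ⊎ 2F ∈ ys
    x₂-dominated with dom x₂
    ... | w , w∈ , x₂~w with neighbours-x₂ w x₂~w
    ...   | inj₁ refl = inj₁ (new∈ w∈)
    ...   | inj₂ refl = inj₂ (new∈ w∈)

    x₃-dominated : 1F ∈ ys ⊎ v ∈ xs
    x₃-dominated with dom x₃
    ... | w , w∈ , x₃~w with neighbours-x₃ w x₃~w
    ...   | inj₁ refl = inj₁ (new∈ w∈)
    ...   | inj₂ refl = inj₂ (old∈ w∈)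

    old-dominated : ∀ a → (∃ λ b → b ∈ xs × adj G a b ≡ true) ⊎ (a ≡ u × 0F ∈ ys) ⊎ (a ≡ v × 2F ∈ ys)
    old-dominated a with dom (old a)
    ... | w , w∈ , a~w with neighbours-old a w a~w
    ...   | inj₁ (b , refl , a~b)   = inj₁ (b , old∈ w∈ , a~b)
    ...   | inj₂ (inj₁ (a≡u , refl)) = inj₂ (inj₁ (a≡u , new∈ w∈))
    ...   | inj₂ (inj₂ (a≡v , refl)) = inj₂ (inj₂ (a≡v , new∈ w∈))

    -- v takes over the role of x₁ as a neighbour of u, and u that of x₃ for v.
    projection-isTotalDominating : adj G u v ≡ true → ∀ S → xs ⊆ S → (0F ∈ ys → v ∈ S) → (2F ∈ ys → u ∈ S) →
                                   IsTotalDominating (adj G) S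
    projection-isTotalDominating uv S xs⊆S x₁↦v x₃↦u a with old-dominated a
    ... | inj₁ (b , b∈ , a~b)        = b , xs⊆S b∈ , a~b
    ... | inj₂ (inj₁ (refl , x₁∈)) = v , x₁↦v x₁∈ , uv
    ... | inj₂ (inj₂ (refl , x₃∈)) = u , x₃↦u x₃∈ , trans (Graph.sym G v u) uv

  module _ (uv : adj G u v ≡ true) where

    shrink : ∀ (xs : Subset n) (ys : Subset 3) → IsTotalDominating G₃ (xs ++ ys) →
             ∃ λ S → IsTotalDominating (adj G) S × ∣ S ∣ < ∣ xs ∣ + ∣ ys ∣
    shrink xs ys@(_ ∷ outside ∷ _ ∷ []) dom
      with Dominated.x₁-dominated xs ys dom | Dominated.x₃-dominated xs ys dom
    ... | inj₂ (there ()) | _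
    ... | _ | inj₁ (there ())
    ... | inj₁ u∈xs | inj₂ v∈xs =
      xs , projection-isTotalDominating uv xs (λ x∈ → x∈) (const v∈xs) (const u∈xs) ,
      m<m+n ∣ xs ∣ ([ x∈p⇒0<∣p∣ , x∈p⇒0<∣p∣ ]′ x₂-dominated)
      where open Dominated xs ys dom
    shrink xs ys@(inside ∷ inside ∷ inside ∷ []) dom =
      (xs ∪ ⁅ v ⁆) ∪ ⁅ u ⁆ ,
      projection-isTotalDominating uv _ (p⊆p∪q ⁅ u ⁆ ∘ p⊆p∪q ⁅ v ⁆)
        (const (p⊆p∪q ⁅ u ⁆ (q⊆p∪q xs ⁅ v ⁆ (x∈⁅x⁆ v)))) (const (q⊆p∪q _ ⁅ u ⁆ (x∈⁅x⁆ u))) ,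
      (begin-strict
        ∣ (xs ∪ ⁅ v ⁆) ∪ ⁅ u ⁆ ∣ ≤⟨ ∣p∪⁅x⁆∣≤1+∣p∣ (xs ∪ ⁅ v ⁆) u ⟩
        1 + ∣ xs ∪ ⁅ v ⁆ ∣      ≤⟨ s≤s (∣p∪⁅x⁆∣≤1+∣p∣ xs v) ⟩
        2 + ∣ xs ∣              <⟨ ≤-refl ⟩
        3 + ∣ xs ∣              ≡⟨ +-comm 3 ∣ xs ∣ ⟩
        ∣ xs ∣ + 3              ∎)
      where open Dominated xs ys dom
            open ≤-Reasoning
    shrink xs ys@(inside ∷ inside ∷ outside ∷ []) dom =
      xs ∪ ⁅ v ⁆ ,
      projection-isTotalDominating uv _ (p⊆p∪q ⁅ v ⁆) (const (q⊆p∪q xs ⁅ v ⁆ (x∈⁅x⁆ v))) (λ { (there (there ())) }) ,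
      ≤-trans (s≤s (∣p∪⁅x⁆∣≤1+∣p∣ xs v)) (≤-reflexive (+-comm 2 ∣ xs ∣))
      where open Dominated xs ys dom
    shrink xs ys@(outside ∷ inside ∷ inside ∷ []) dom =
      xs ∪ ⁅ u ⁆ ,
      projection-isTotalDominating uv _ (p⊆p∪q ⁅ u ⁆) (λ ()) (const (q⊆p∪q xs ⁅ u ⁆ (x∈⁅x⁆ u))) ,
      ≤-trans (s≤s (∣p∪⁅x⁆∣≤1+∣p∣ xs u)) (≤-reflexive (+-comm 2 ∣ xs ∣))
      where open Dominated xs ys dom
    shrink xs ys@(outside ∷ inside ∷ outside ∷ []) dom =
      xs , projection-isTotalDominating uv xs (λ x∈ → x∈) (λ ()) (λ { (there (there ())) }) ,
      m<m+n ∣ xs ∣ (s≤s z≤n)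
      where open Dominated xs ys dom

    subdivision-shrinks : ∀ S′ → IsTotalDominating G₃ S′ →
                          ∃ λ S → IsTotalDominating (adj G) S × ∣ S ∣ < ∣ S′ ∣
    subdivision-shrinks S′ dom with Vec.splitAt n S′
    ... | xs , ys , refl with shrink xs ys dom
    ...   | S , domS , S<S′ = S , domS , <-≤-trans S<S′ (≤-reflexive (sym (∣p++q∣≡∣p∣+∣q∣ xs ys)))

    subdivision-increases : NoIsolatedVertex (adj G) → SubdivisionIncreases G u v 3
    subdivision-increases noIso with totalDomNumber-exists (⊤-isTotalDominating noIso)
                                   | totalDomNumber-exists (⊤-isTotalDominating (noIsolatedVertex noIso))
    ... | k , γ | k′ , γ₃ = k , k′ , γ , γ₃ , totalDomNumber-< γ γ₃ subdivision-shrinks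

connected⇒noIsolatedVertex : ∀ {n} {G : Graph n} → 2 ≤ n → Connected G → NoIsolatedVertex (adj G)
connected⇒noIsolatedVertex (s≤s (s≤s z≤n)) conn 0F with conn 0F 1F
... | step {b = b} 0~b _ = b , 0~b
connected⇒noIsolatedVertex (s≤s (s≤s z≤n)) conn (suc a) with conn (suc a) 0F
... | step {b = b} a~b _ = b , a~b

theorem7 : (n : ℕ) → (G : Graph n) → 2 ≤ n → Connected G → MsdAtMost G 3
theorem7 zero    G ()  _
theorem7 (suc n) G 2≤n conn =
  let v , uv = noIso 0F
  in 0F , v , uv , 3 , s≤s z≤n , ≤-refl , ThreefoldSubdivision.subdivision-increases G 0F v uv noIso
  where
  noIso : NoIsolatedVertex (adj G)
  noIso = connected⇒noIsolatedVertex {G = G} 2≤n conn
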